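{- Let $\pi$ be a QBAL proof of $\Phi;A_1,\dots,A_n\vdash B$, let $x_1,\dots,x_k$ be resource variables and $p_1,\dots,p_k$ resource polynomials. Then there is a QBAL proof $\pi\{\overline{p}/\overline{x}\}$ of $\Phi\{\overline{p}/\overline{x}\};A_1\{\overline{p}/\overline{x}\},\dots,A_n\{\overline{p}/\overline{x}\}\vdash B\{\overline{p}/\overline{x}\}$ such that $\lfloor\pi\{\overline{p}/\overline{x}\}\rfloor=\lfloor\pi\rfloor$.
   Context: Resource polynomials: finite sums of finite products $\prod_i\binom{x_i}{n_i}$ (pairwise distinct variables, $n_i\in\mathbb{N}$), read as functions of natural-number variables. A constraint is $p\le q$ for resource polynomials; $p<q$ abbreviates $p+1\le q$; a constraint set is a finite set of constraints. $\Phi\models c$: every assignment of naturals satisfying all of $\Phi$ satisfies $c$; $\Phi\models\Psi$: $\Phi\models c$ for all $c\in\Psi$; $p\sqsubseteq_\Phi q$: $\Phi\models p\le q$. Formulas: $A::=\alpha(p_1,\dots,p_n)\mid A\otimes A\mid A\multimap A\mid\forall\alpha.A\mid\,!_{x<p}A\mid\forall(x_1,\dots,x_n){:}\Phi.A\mid\exists(x_1,\dots,x_n){:}\Phi.A$ ($\alpha$ atoms with fixed arities, $x\notin FV(p)$, and boundedness: for each quantifier formula there are resource polynomials $r_i$ not containing $\overline{x}$ with $\Phi\models\{x_i\le r_i\}_i$). $!_{x<p}$ binds $x$; quantifiers bind $\overline{x}$ in $\Phi$ and body; formulas up to renaming of bound variables; substitutions ($A\{\overline{p}/\overline{x}\}$,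 $\Phi\{\overline{p}/\overline{x}\}$) are capture-avoiding and simultaneous. Polarity: variables of $p_i$ positive in $\alpha(\overline{p})$; in $p\le q$, $p$ negative, $q$ positive; reversed in first argument of $\multimap$, in $p$ of $!_{x<p}$, in the constraint set of $\forall\overline{x}{:}\Phi$; preserved elsewhere. $A\{B/\alpha(x_1,\dots,x_n)\}$ (for $B$ in which $x_1..x_n$ occur only positively) replaces each free $\alpha(p_1,\dots,p_n)$ by $B\{\overline{p}/\overline{x}\}$. Order: $\alpha(\overline{p})\le_\Phi\alpha(\overline{q})$ iff $p_i\sqsubseteq_\Phi q_i$; $\otimes$ covariant in both; $A\multimap B\le_\Phi C\multimap D$ iff $C\le_\Phi A$, $B\le_\Phi D$; $\forall\alpha.A\le_\Phi\forall\alpha.B$ iff $A\le_\Phi B$; $!_{x<p}A\le_\Phi!_{x<q}B$ iff $q\sqsubseteq_\Phi p$, $x\notin FV(\Phi)$, $A\le_{\Phi\cup\{x<q\}}B$; $\forall\overline{x}{:}\Psi.A\le_\Phi\forall\overline{x}{:}\Theta.B$ iff $\Phi\cup\Theta\models\Psi$, $\overline{x}\notin FV(\Phi)$, $A\le_{\Phi\cup\Theta}B$; $\exists\overline{x}{:}\Psi.A\le_\Phi\exists\overline{x}{:}\Theta.B$ iff $\Phi\cup\Psi\models\Theta$, $\overline{x}\notin FV(\Phi)$, $A\le_{\Phi\cup\Psi}B$. QBAL judgements $\Phi;\Gamma\vdash A$ ($\Gamma$ a multiset of formulas) are derived by the rules: (A) $\Phi;A\vdash B$ if $A\le_\Phi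 B$. (U) from $\Phi;\Gamma\vdash A$ and $\Phi;\Delta,A\vdash B$ infer $\Phi;\Gamma,\Delta\vdash B$. (W) from $\Phi;\Gamma\vdash B$ infer $\Phi;\Gamma,A\vdash B$. (X) from $\Phi;\Gamma,!_{x<p}A,!_{y<q}A\{p+y/x\}\vdash B$ and $p+q\sqsubseteq_\Phi r$ infer $\Phi;\Gamma,!_{x<r}A\vdash B$. ($R_\multimap$) from $\Phi;\Gamma,A\vdash B$ infer $\Phi;\Gamma\vdash A\multimap B$. ($L_\multimap$) from $\Phi;\Gamma\vdash A$ and $\Phi;\Delta,B\vdash C$ infer $\Phi;\Gamma,\Delta,A\multimap B\vdash C$. ($R_\otimes$) from $\Phi;\Gamma\vdash A$ and $\Phi;\Delta\vdash B$ infer $\Phi;\Gamma,\Delta\vdash A\otimes B$. ($L_\otimes$) from $\Phi;\Gamma,A,B\vdash C$ infer $\Phi;\Gamma,A\otimes B\vdash C$. ($P_!$) from $\Phi;A_1,\dots,A_n\vdash B$, with $\Psi\cup\{x<p\}\models\Phi$, $x\notin FV(\Psi)$ and $p\sqsubseteq_\Psi q_i$ for all $i$, infer $\Psi;!_{x<q_1}A_1,\dots,!_{x<q_n}A_n\vdash\,!_{x<p}B$. ($D_!$) from $\Phi;A\{1/x\},\Gamma\vdash B$ and $1\sqsubseteq_\Phi p$ infer $\Phi;!_{x<p}A,\Gamma\vdash B$. ($N_!$) from $\Phi;!_{y<p}!_{z<q\{y/w\}}A\{(z+\sum_{w<y}q)/x\},\Gamma\vdash B$ and $\sum_{w<p}q\sqsubseteq_\Phi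 r$ infer $\Phi;!_{x<r}A,\Gamma\vdash B$. ($R_{\forall\alpha}$) from $\Phi;\Gamma\vdash A$, $\alpha$ not free in $\Gamma$, infer $\Phi;\Gamma\vdash\forall\alpha.A$. ($L_{\forall\alpha}$) from $\Phi;\Gamma,A\{B/\alpha(x_1,\dots,x_n)\}\vdash C$ infer $\Phi;\Gamma,\forall\alpha.A\vdash C$. ($R_{\forall x}$) from $\Phi\cup\Psi;\Gamma\vdash A$, $\overline{x}\notin FV(\Gamma)\cup FV(\Phi)$, infer $\Phi;\Gamma\vdash\forall\overline{x}{:}\Psi.A$. ($L_{\forall x}$) from $\Phi;\Gamma,A\{\overline{p}/\overline{x}\}\vdash C$ and $\Phi\models\Psi\{\overline{p}/\overline{x}\}$ infer $\Phi;\Gamma,\forall\overline{x}{:}\Psi.A\vdash C$. ($R_{\exists x}$) from $\Phi;\Gamma\vdash A\{\overline{p}/\overline{x}\}$ and $\Phi\models\Psi\{\overline{p}/\overline{x}\}$ infer $\Phi;\Gamma\vdash\exists\overline{x}{:}\Psi.A$. ($L_{\exists x}$) from $\Phi\cup\Psi;\Gamma,A\vdash C$, $\overline{x}\notin FV(\Gamma)\cup FV(C)\cup FV(\Phi)$, infer $\Phi;\Gamma,\exists\overline{x}{:}\Psi.A\vdash C$. Erasure: formulas erase to second-order intuitionistic propositional formulas by $\alpha(\overline{p})\mapsto\alpha$, $\otimes\mapsto\wedge$, $\multimap\mapsto\to$, $\forall\alpha\mapsto\forall\alpha$, and $!_{x<p}A$, $\forall\overline{x}{:}\Phi.A$, $\exists\overline{x}{:}\Phi.A\mapsto$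 erasure of $A$. $\lfloor\pi\rfloor$ is the proof in the sequent calculus for second-order intuitionistic propositional logic (axiom, cut, weakening, contraction, left/right rules for $\to,\wedge,\forall\alpha$) obtained by erasing every formula, dropping constraint sets, deleting every instance of $P_!,D_!,N_!,R_{\forall x},L_{\forall x},R_{\exists x},L_{\exists x}$ (whose erased premise equals the erased conclusion), and mapping A, U, W, X, $R/L_\multimap$, $R/L_\otimes$, $R/L_{\forall\alpha}$ to axiom, cut, weakening, contraction, $R/L_\to$, $R/L_\wedge$, $R/L_\forall$. -}

module Defs where

-- Conventions: de Bruijn indices for all binders.

open import Data.Nat using (ℕ; zero; suc; _+_; _*_; _≤_; _≡ᵇ_)
open import Data.Nat.Combinatorics using (_C_)
open import Data.Bool using (Bool; true; false; _∨_; if_then_else_)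
open import Data.Fin using (Fin; toℕ)
open import Data.Vec using (Vec; []; _∷_; tabulate)
import Data.Vec as Vec
open import Data.List using (List; []; _∷_; map; _++_)
open import Data.List.Relation.Unary.All using (All)
open import Data.Product using (_×_; _,_; Σ; ∃; proj₁; proj₂)
open import Data.Unit using (⊤)
open import Relation.Binary.PropositionalEquality using (_≡_)

-- Resource polynomials (syntax, de Bruijn variables)
--   var i      : the resource variable with index i
--   lit n      : the constant n
--   p ⊕ q, p ⊛ q : sum and product
--   bin p n    : binomial coefficient  (p choose n)
--   sumP p q   : Σ_{w<p} q   (binds w = index 0 in q)
-- Every such expression denotes a resource polynomial (closure of the
-- sums-of-products-of-binomials under these operations), and these are
-- exactly the operations the paper applies to resource polynomials.

infixl 6 _⊕_
infixl 7 _⊛_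

data Poly : Set where
  var  : ℕ → Poly
  lit  : ℕ → Poly
  _⊕_  : Poly → Poly → Poly
  _⊛_  : Poly → Poly → Poly
  bin  : Poly → ℕ → Poly
  sumP : Poly → Poly → Poly

Assignment : Set
Assignment = ℕ → ℕ

_∷ₐ_ : ℕ → Assignment → Assignment
(v ∷ₐ ρ) zero    = v
(v ∷ₐ ρ) (suc i) = ρ i

sumBelow : ℕ → (ℕ → ℕ) → ℕ
sumBelow zero    f = 0
sumBelow (suc n) f = sumBelow n f + f n

⟦_⟧ : Poly → Assignment → ℕ
⟦ var i ⟧    ρ = ρ i
⟦ lit n ⟧    ρ = n
⟦ p ⊕ q ⟧    ρ = ⟦ p ⟧ ρ + ⟦ q ⟧ ρ
⟦ p ⊛ q ⟧    ρ = ⟦ p ⟧ ρ * ⟦ q ⟧ ρ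
⟦ bin p n ⟧  ρ = ⟦ p ⟧ ρ C n
⟦ sumP p q ⟧ ρ = sumBelow (⟦ p ⟧ ρ) (λ w → ⟦ q ⟧ (w ∷ₐ ρ))

ext : (ℕ → ℕ) → ℕ → ℕ
ext r zero    = zero
ext r (suc i) = suc (r i)

renP : (ℕ → ℕ) → Poly → Poly
renP r (var i)    = var (r i)
renP r (lit n)    = lit n
renP r (p ⊕ q)    = renP r p ⊕ renP r q
renP r (p ⊛ q)    = renP r p ⊛ renP r q
renP r (bin p n)  = bin (renP r p) n
renP r (sumP p q) = sumP (renP r p) (renP (ext r) q)

Sub : Set
Sub = ℕ → Poly

exts : Sub → Sub
exts σ zero    = var zero
exts σ (suc i) = renP suc (σ i)

extsN : ℕ → Sub → Sub
extsN zero    σ = σ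
extsN (suc n) σ = exts (extsN n σ)

subP : Sub → Poly → Poly
subP σ (var i)    = σ i
subP σ (lit n)    = lit n
subP σ (p ⊕ q)    = subP σ p ⊕ subP σ q
subP σ (p ⊛ q)    = subP σ p ⊛ subP σ q
subP σ (bin p n)  = bin (subP σ p) n
subP σ (sumP p q) = sumP (subP σ p) (subP (exts σ) q)

wkSub : ℕ → Sub
wkSub n i = var (n + i)

-- instantiate the first k variables by ps (x_j = index j), others shift down
instV : ∀ {k} → Vec Poly k → Sub
instV []       i       = var i
instV (p ∷ ps) zero    = p
instV (p ∷ ps) (suc i) = instV ps i

occP : ℕ → Poly → Bool
occP i (var j)    = i ≡ᵇ j
occP i (lit n)    = false
occP i (p ⊕ q)    = occP i p ∨ occP i q
occP i (p ⊛ q)    = occP i p ∨ occP i q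
occP i (bin p n)  = occP i p
occP i (sumP p q) = occP i p ∨ occP (suc i) q

infix 4 _≤c_

data Con : Set where
  _≤c_ : Poly → Poly → Con

_<c_ : Poly → Poly → Con
p <c q = (p ⊕ lit 1) ≤c q

ConSet : Set
ConSet = List Con

subC : Sub → Con → Con
subC σ (p ≤c q) = subP σ p ≤c subP σ q

subCs : Sub → ConSet → ConSet
subCs σ = map (subC σ)

Holds : Assignment → Con → Set
Holds ρ (p ≤c q) = ⟦ p ⟧ ρ ≤ ⟦ q ⟧ ρ

infix 3 _⊨_ _⊨*_

_⊨_ : ConSet → Con → Set
Φ ⊨ c = (ρ : Assignment) → All (Holds ρ) Φ → Holds ρ c

_⊨*_ : ConSet → ConSet → Set
Φ ⊨* Ψ = All (Φ ⊨_) Ψ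

_⊑[_]_ : Poly → ConSet → Poly → Set
p ⊑[ Φ ] q = Φ ⊨ (p ≤c q)

-- Formulas
--   atom k a ps : α(p_1..p_k), α the atom variable of arity k with
--                 de Bruijn index a (indices counted among binders ∀α of
--                 the same arity k)
--   ∀α k A      : ∀α.A with α of arity k
--   ! p A       : !_{x<p} A   (binds x = index 0 in A; p outside)
--   ∀x n Φ A    : ∀(x_1..x_n):Φ.A  (binds x_j = index j-1 in Φ and A)
--   ∃x n Φ A    : ∃(x_1..x_n):Φ.A

infixr 6 _⊗_
infixr 5 _⊸_

data Form : Set where
  atom : (k a : ℕ) → Vec Poly k → Form
  _⊗_  : Form → Form → Form
  _⊸_  : Form → Form → Form
  ∀α   : ℕ → Form → Form
  !    : Poly → Form → Form
  ∀x   : ℕ → ConSet → Form → Form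
  ∃x   : ℕ → ConSet → Form → Form

subF : Sub → Form → Form
subF σ (atom k a ps) = atom k a (Vec.map (subP σ) ps)
subF σ (A ⊗ B)       = subF σ A ⊗ subF σ B
subF σ (A ⊸ B)       = subF σ A ⊸ subF σ B
subF σ (∀α k A)      = ∀α k (subF σ A)
subF σ (! p A)       = ! (subP σ p) (subF (exts σ) A)
subF σ (∀x n Φ A)    = ∀x n (subCs (extsN n σ) Φ) (subF (extsN n σ) A)
subF σ (∃x n Φ A)    = ∃x n (subCs (extsN n σ) Φ) (subF (extsN n σ) A)

liftr : ℕ → (ℕ → ℕ → ℕ) → ℕ → ℕ → ℕ
liftr k′ r k a with k ≡ᵇ k′
liftr k′ r k zero    | true  = zero
liftr k′ r k (suc a) | true  = suc (r k a)
... | false = r k a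

renα : (ℕ → ℕ → ℕ) → Form → Form
renα r (atom k a ps) = atom k (r k a) ps
renα r (A ⊗ B)       = renα r A ⊗ renα r B
renα r (A ⊸ B)       = renα r A ⊸ renα r B
renα r (∀α k A)      = ∀α k (renα (liftr k r) A)
renα r (! p A)       = ! p (renα r A)
renα r (∀x n Φ A)    = ∀x n Φ (renα r A)
renα r (∃x n Φ A)    = ∃x n Φ (renα r A)

shiftα : ℕ → Form → Form
shiftα k′ = renα (λ k a → if k ≡ᵇ k′ then suc a else a)

idT : (k a : ℕ) → Form
idT k a = atom k a (tabulate (λ i → var (toℕ i)))

-- simultaneous atom substitution: τ k a is a template for the atom
-- variable (k , a) whose resource variables 0..k-1 are its arguments
Tmpl : Set
Tmpl = (k : ℕ) → ℕ → Form

liftτ : ℕ → Tmpl → Tmpl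
liftτ k′ τ k a with k ≡ᵇ k′
liftτ k′ τ k zero    | true = idT k zero
liftτ k′ τ k (suc a) | true = shiftα k′ (τ k a)
... | false = shiftα k′ (τ k a)

subα : Tmpl → Form → Form
subα τ (atom k a ps) = subF (instV ps) (τ k a)
subα τ (A ⊗ B)       = subα τ A ⊗ subα τ B
subα τ (A ⊸ B)       = subα τ A ⊸ subα τ B
subα τ (∀α k A)      = ∀α k (subα (liftτ k τ) A)
subα τ (! p A)       = ! p (subα (λ k a → subF (extsN k (wkSub 1)) (τ k a)) A)
subα τ (∀x n Φ A)    = ∀x n Φ (subα (λ k a → subF (extsN k (wkSub n)) (τ k a)) A)
subα τ (∃x n Φ A)    = ∃x n Φ (subα (λ k a → subF (extsN k (wkSub n)) (τ k a)) A)

-- A{B/α(x_1..x_k)} for the body A of ∀α k A (α = atom (k , 0));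
-- B has x_j as resource index j-1
instα : (k : ℕ) → Form → Tmpl
instα k B k′ a with k′ ≡ᵇ k
instα k B k′ zero    | true = B
instα k B k′ (suc a) | true = idT k′ a
... | false = idT k′ a

_[_/α_] : Form → Form → ℕ → Form
A [ B /α k ] = subα (instα k B) A

anyV : ∀ {k} → (Poly → Bool) → Vec Poly k → Bool
anyV f []       = false
anyV f (p ∷ ps) = f p ∨ anyV f ps

posC negC : ℕ → ConSet → Bool
posC i []             = false
posC i ((p ≤c q) ∷ Φ) = occP i q ∨ posC i Φ
negC i []             = false
negC i ((p ≤c q) ∷ Φ) = occP i p ∨ negC i Φ

posOcc negOcc : ℕ → Form → Bool
posOcc i (atom k a ps) = anyV (occP i) ps
posOcc i (A ⊗ B)       = posOcc i A ∨ posOcc i B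
posOcc i (A ⊸ B)       = negOcc i A ∨ posOcc i B
posOcc i (∀α k A)      = posOcc i A
posOcc i (! p A)       = posOcc (suc i) A
posOcc i (∀x n Φ A)    = negC (n + i) Φ ∨ posOcc (n + i) A
posOcc i (∃x n Φ A)    = posC (n + i) Φ ∨ posOcc (n + i) A
negOcc i (atom k a ps) = false
negOcc i (A ⊗ B)       = negOcc i A ∨ negOcc i B
negOcc i (A ⊸ B)       = posOcc i A ∨ negOcc i B
negOcc i (∀α k A)      = negOcc i A
negOcc i (! p A)       = occP i p ∨ negOcc (suc i) A
negOcc i (∀x n Φ A)    = posC (n + i) Φ ∨ negOcc (n + i) A
negOcc i (∃x n Φ A)    = negC (n + i) Φ ∨ negOcc (n + i) A

-- Well-formedness: boundedness of quantifier formulas.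
-- For ∀/∃(x_1..x_n):Φ.A there are r_i not containing the x̄ (i.e. in the
-- outer scope, weakened by n) with Φ ⊨ x_i ≤ r_i.

Bounded : ℕ → ConSet → Set
Bounded n Φ = (i : Fin n) → ∃ λ r → Φ ⊨ (var (toℕ i) ≤c renP (n +_) r)

WF : Form → Set
WF (atom k a ps) = ⊤
WF (A ⊗ B)       = WF A × WF B
WF (A ⊸ B)       = WF A × WF B
WF (∀α k A)      = WF A
WF (! p A)       = WF A
WF (∀x n Φ A)    = Bounded n Φ × WF A
WF (∃x n Φ A)    = Bounded n Φ × WF A

wkCs : ℕ → ConSet → ConSet
wkCs n = subCs (wkSub n)

wkF : ℕ → Form → Form
wkF n = subF (wkSub n)

data PolyLE (Φ : ConSet) : ∀ {k} → Vec Poly k → Vec Poly k → Set where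
  []  : PolyLE Φ [] []
  _∷_ : ∀ {k p q} {ps qs : Vec Poly k} →
        p ⊑[ Φ ] q → PolyLE Φ ps qs → PolyLE Φ (p ∷ ps) (q ∷ qs)

data _≤[_]_ : Form → ConSet → Form → Set where
  atom≤ : ∀ {Φ k a} {ps qs : Vec Poly k} →
          PolyLE Φ ps qs → atom k a ps ≤[ Φ ] atom k a qs
  ⊗≤    : ∀ {Φ A B C D} → A ≤[ Φ ] C → B ≤[ Φ ] D → (A ⊗ B) ≤[ Φ ] (C ⊗ D)
  ⊸≤    : ∀ {Φ A B C D} → C ≤[ Φ ] A → B ≤[ Φ ] D → (A ⊸ B) ≤[ Φ ] (C ⊸ D)
  ∀α≤   : ∀ {Φ k A B} → A ≤[ Φ ] B → ∀α k A ≤[ Φ ] ∀α k B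
  !≤    : ∀ {Φ p q A B} → q ⊑[ Φ ] p →
          A ≤[ wkCs 1 Φ ++ (var 0 <c renP suc q) ∷ [] ] B →
          ! p A ≤[ Φ ] ! q B
  ∀x≤   : ∀ {Φ n Ψ Θ A B} → wkCs n Φ ++ Θ ⊨* Ψ →
          A ≤[ wkCs n Φ ++ Θ ] B → ∀x n Ψ A ≤[ Φ ] ∀x n Θ B
  ∃x≤   : ∀ {Φ n Ψ Θ A B} → wkCs n Φ ++ Ψ ⊨* Θ →
          A ≤[ wkCs n Φ ++ Ψ ] B → ∃x n Ψ A ≤[ Φ ] ∃x n Θ B

-- QBAL derivations  Φ ; Γ ⊢ A   (Γ a list; explicit exchange rule
-- stands for Γ being a multiset; principal formulas are written first)

-- A{1/x}, A{p+y/x} (y = index 0 of the new binder), A{(z + Σ_{w<y} q)/x}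
sub1 : Poly → Sub
sub1 p zero    = p
sub1 p (suc i) = var i

subXp : Poly → Sub        -- for A under !_{x<...}: x ↦ p + y, rest fixed
subXp p zero    = renP suc p ⊕ var zero
subXp p (suc i) = var (suc i)

-- q lives in scope (w , outer); inside Σ_{w<y} in scope (w , z , y , outer)
renQ : ℕ → ℕ
renQ zero    = zero
renQ (suc i) = suc (suc (suc i))

subN : Poly → Sub         -- x ↦ z + Σ_{w<y} q   (z = 0, y = 1)
subN q zero    = var zero ⊕ sumP (var 1) (renP renQ q)
subN q (suc i) = var (suc (suc i))

infix 2 _⨾_⊢_

data _⨾_⊢_ : ConSet → List Form → Form → Set where
  Ax   : ∀ {Φ A B} → A ≤[ Φ ] B → Φ ⨾ A ∷ [] ⊢ B
  Cut  : ∀ {Φ Γ Δ A B} → WF A → Φ ⨾ Γ ⊢ A → Φ ⨾ A ∷ Δ ⊢ B → Φ ⨾ Γ ++ Δ ⊢ B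
  Wk   : ∀ {Φ Γ A B} → Φ ⨾ Γ ⊢ B → Φ ⨾ A ∷ Γ ⊢ B
  Exch : ∀ {Φ} Γ {A B Δ C} → Φ ⨾ Γ ++ A ∷ B ∷ Δ ⊢ C → Φ ⨾ Γ ++ B ∷ A ∷ Δ ⊢ C
  Ctr  : ∀ {Φ Γ p q r A B} →
         Φ ⨾ ! p A ∷ ! q (subF (subXp p) A) ∷ Γ ⊢ B →
         (p ⊕ q) ⊑[ Φ ] r →
         Φ ⨾ ! r A ∷ Γ ⊢ B
  R⊸   : ∀ {Φ Γ A B} → Φ ⨾ A ∷ Γ ⊢ B → Φ ⨾ Γ ⊢ A ⊸ B
  L⊸   : ∀ {Φ Γ Δ A B C} → Φ ⨾ Γ ⊢ A → Φ ⨾ B ∷ Δ ⊢ C →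
         Φ ⨾ (A ⊸ B) ∷ Γ ++ Δ ⊢ C
  R⊗   : ∀ {Φ Γ Δ A B} → Φ ⨾ Γ ⊢ A → Φ ⨾ Δ ⊢ B → Φ ⨾ Γ ++ Δ ⊢ A ⊗ B
  L⊗   : ∀ {Φ Γ A B C} → Φ ⨾ A ∷ B ∷ Γ ⊢ C → Φ ⨾ (A ⊗ B) ∷ Γ ⊢ C
  P!   : ∀ {Φ Ψ p B} (qAs : List (Poly × Form)) →
         Φ ⨾ map proj₂ qAs ⊢ B →
         wkCs 1 Ψ ++ (var 0 <c renP suc p) ∷ [] ⊨* Φ →
         All (λ qA → p ⊑[ Ψ ] proj₁ qA) qAs →
         Ψ ⨾ map (λ qA → ! (proj₁ qA) (proj₂ qA)) qAs ⊢ ! p B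
  D!   : ∀ {Φ Γ p A B} → Φ ⨾ subF (sub1 (lit 1)) A ∷ Γ ⊢ B →
         lit 1 ⊑[ Φ ] p → Φ ⨾ ! p A ∷ Γ ⊢ B
  N!   : ∀ {Φ Γ p q r A B} →
         Φ ⨾ ! p (! q (subF (subN q) A)) ∷ Γ ⊢ B →
         sumP p q ⊑[ Φ ] r → Φ ⨾ ! r A ∷ Γ ⊢ B
  R∀α  : ∀ {Φ Γ k A} → Φ ⨾ map (shiftα k) Γ ⊢ A → Φ ⨾ Γ ⊢ ∀α k A
  L∀α  : ∀ {Φ Γ k A B C} →
         WF B → ((i : Fin k) → negOcc (toℕ i) B ≡ false) →
         Φ ⨾ (A [ B /α k ]) ∷ Γ ⊢ C → Φ ⨾ ∀α k A ∷ Γ ⊢ C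
  R∀x  : ∀ {Φ Γ n Ψ A} → wkCs n Φ ++ Ψ ⨾ map (wkF n) Γ ⊢ A →
         Φ ⨾ Γ ⊢ ∀x n Ψ A
  L∀x  : ∀ {Φ Γ n Ψ A C} (ps : Vec Poly n) →
         Φ ⨾ subF (instV ps) A ∷ Γ ⊢ C → Φ ⊨* subCs (instV ps) Ψ →
         Φ ⨾ ∀x n Ψ A ∷ Γ ⊢ C
  R∃x  : ∀ {Φ Γ n Ψ A} (ps : Vec Poly n) →
         Φ ⨾ Γ ⊢ subF (instV ps) A → Φ ⊨* subCs (instV ps) Ψ →
         Φ ⨾ Γ ⊢ ∃x n Ψ A
  L∃x  : ∀ {Φ Γ n Ψ A C} →
         wkCs n Φ ++ Ψ ⨾ A ∷ map (wkF n) Γ ⊢ wkF n C →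
         Φ ⨾ ∃x n Ψ A ∷ Γ ⊢ C

-- Second-order intuitionistic propositional logic: formulas and
-- sequent-calculus proof trees (each node: rule name, conclusion
-- sequent, premises).

infixr 6 _∧₂_
infixr 5 _⇒₂_

data PForm : Set where
  pv    : (k a : ℕ) → PForm
  _∧₂_  : PForm → PForm → PForm
  _⇒₂_  : PForm → PForm → PForm
  ∀₂    : ℕ → PForm → PForm          -- binds the variable (k , 0)

data Rule₂ : Set where
  axiom cut weakening contraction exchange R⇒ L⇒ R∧ L∧ R∀ L∀ : Rule₂

data Proof₂ : Set where
  node : Rule₂ → List PForm → PForm → List Proof₂ → Proof₂

eraseF : Form → PForm
eraseF (atom k a ps) = pv k a
eraseF (A ⊗ B)       = eraseF A ∧₂ eraseF B
eraseF (A ⊸ B)       = eraseF A ⇒₂ eraseF B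
eraseF (∀α k A)      = ∀₂ k (eraseF A)
eraseF (! p A)       = eraseF A
eraseF (∀x n Φ A)    = eraseF A
eraseF (∃x n Φ A)    = eraseF A

mutual
  ⌊_⌋ : ∀ {Φ Γ A} → Φ ⨾ Γ ⊢ A → Proof₂
  ⌊_⌋ {Γ = Γ} {A} π = erase′ (map eraseF Γ) (eraseF A) π

  erase′ : ∀ {Φ Γ A} → List PForm → PForm → Φ ⨾ Γ ⊢ A → Proof₂
  erase′ Γ A (Ax _)          = node axiom Γ A []
  erase′ Γ A (Cut _ π₁ π₂)   = node cut Γ A (⌊ π₁ ⌋ ∷ ⌊ π₂ ⌋ ∷ [])
  erase′ Γ A (Wk π)          = node weakening Γ A (⌊ π ⌋ ∷ [])
  erase′ Γ A (Exch _ π)      = node exchange Γ A (⌊ π ⌋ ∷ [])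
  erase′ Γ A (Ctr π _)       = node contraction Γ A (⌊ π ⌋ ∷ [])
  erase′ Γ A (R⊸ π)          = node R⇒ Γ A (⌊ π ⌋ ∷ [])
  erase′ Γ A (L⊸ π₁ π₂)      = node L⇒ Γ A (⌊ π₁ ⌋ ∷ ⌊ π₂ ⌋ ∷ [])
  erase′ Γ A (R⊗ π₁ π₂)      = node R∧ Γ A (⌊ π₁ ⌋ ∷ ⌊ π₂ ⌋ ∷ [])
  erase′ Γ A (L⊗ π)          = node L∧ Γ A (⌊ π ⌋ ∷ [])
  erase′ Γ A (P! _ π _ _)    = ⌊ π ⌋
  erase′ Γ A (D! π _)        = ⌊ π ⌋
  erase′ Γ A (N! π _)        = ⌊ π ⌋
  erase′ Γ A (R∀α π)         = node R∀ Γ A (⌊ π ⌋ ∷ [])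
  erase′ Γ A (L∀α _ _ π)     = node L∀ Γ A (⌊ π ⌋ ∷ [])
  erase′ Γ A (R∀x π)         = ⌊ π ⌋
  erase′ Γ A (L∀x _ π _)     = ⌊ π ⌋
  erase′ Γ A (R∃x _ π _)     = ⌊ π ⌋
  erase′ Γ A (L∃x π)         = ⌊ π ⌋

_↦_ : ∀ {k} → Vec ℕ k → Vec Poly k → Sub
([] ↦ [])             i = var i
((x ∷ xs) ↦ (p ∷ ps)) i = if i ≡ᵇ x then p else (xs ↦ ps) i

-- Induction on π, for an arbitrary simultaneous substitution σ of resource
-- polynomials for resource variables.  Every side condition of a rule is an
-- entailment Φ ⊨ c, and entailments are stable under σ because
-- ⟦ p σ ⟧ ρ = ⟦ p ⟧ (⟦ σ ⟧ ρ).  The substitutions built into the rules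
-- (A{1/x}, A{p+y/x}, A{(z + Σ_{w<y} q)/x}, instantiation of ∀x̄ and ∃x̄,
-- weakening under binders and second-order instantiation A{B/α}) all commute
-- with σ once σ is lifted under the binders they cross, and σ leaves bound
-- variables alone, so boundedness and the polarity of instantiated variables
-- are preserved.  Erasure forgets resource polynomials altogether, so each
-- rule of π is sent to the same rule and ⌊ π σ ⌋ = ⌊ π ⌋.

module Submission where

open import Defs
open import Function using (_∘_)
open import Data.Nat using (ℕ; zero; suc; _+_; _*_; _≡ᵇ_; _≤_)
open import Data.Nat.Properties using (≡ᵇ⇒≡)
open import Data.Nat.Combinatorics using () renaming (_C_ to _choose_)
open import Data.Bool using (true; false; _∨_; T)
open import Data.Unit using (tt)
open import Data.Fin using (Fin; toℕ)
open import Data.Vec using (Vec; toList; []; _∷_)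
import Data.Vec as Vec
import Data.Vec.Properties as Vecₚ
open import Data.List using (List; map; []; _∷_; _++_; [_])
open import Data.List.Properties using (map-++; map-cong; map-∘)
open import Data.List.Relation.Unary.All using (All; []; _∷_)
import Data.List.Relation.Unary.All as All
open import Data.List.Relation.Unary.All.Properties using (map⁺; map⁻)
open import Data.List.Relation.Unary.Unique.Propositional using (Unique)
open import Data.Product using (Σ; _,_; proj₁; proj₂; _×_)
open import Relation.Binary.PropositionalEquality hiding ([_])
open ≡-Reasoning

infixl 8 _∘ˢ_

_∘ˢ_ : Sub → Sub → Sub
(σ ∘ˢ τ) i = subP σ (τ i)

ext-cong : ∀ {r r′ : ℕ → ℕ} → r ≗ r′ → ext r ≗ ext r′
ext-cong r≗r′ zero    = refl
ext-cong r≗r′ (suc i) = cong suc (r≗r′ i)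

exts-cong : ∀ {σ σ′} → σ ≗ σ′ → exts σ ≗ exts σ′
exts-cong σ≗σ′ zero    = refl
exts-cong σ≗σ′ (suc i) = cong (renP suc) (σ≗σ′ i)

extsN-cong : ∀ n {σ σ′} → σ ≗ σ′ → extsN n σ ≗ extsN n σ′
extsN-cong zero    σ≗σ′ = σ≗σ′
extsN-cong (suc n) σ≗σ′ = exts-cong (extsN-cong n σ≗σ′)

renP-cong : ∀ {r r′} → r ≗ r′ → ∀ p → renP r p ≡ renP r′ p
renP-cong h (var i)    = cong var (h i)
renP-cong h (lit n)    = refl
renP-cong h (p ⊕ q)    = cong₂ _⊕_ (renP-cong h p) (renP-cong h q)
renP-cong h (p ⊛ q)    = cong₂ _⊛_ (renP-cong h p) (renP-cong h q)
renP-cong h (bin p n)  = cong (λ x → bin x n) (renP-cong h p)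
renP-cong h (sumP p q) = cong₂ sumP (renP-cong h p) (renP-cong (ext-cong h) q)

subP-cong : ∀ {σ σ′} → σ ≗ σ′ → ∀ p → subP σ p ≡ subP σ′ p
subP-cong h (var i)    = h i
subP-cong h (lit n)    = refl
subP-cong h (p ⊕ q)    = cong₂ _⊕_ (subP-cong h p) (subP-cong h q)
subP-cong h (p ⊛ q)    = cong₂ _⊛_ (subP-cong h p) (subP-cong h q)
subP-cong h (bin p n)  = cong (λ x → bin x n) (subP-cong h p)
subP-cong h (sumP p q) = cong₂ sumP (subP-cong h p) (subP-cong (exts-cong h) q)

ext-∘ : ∀ r r′ → ext r ∘ ext r′ ≗ ext (r ∘ r′)
ext-∘ r r′ zero    = refl
ext-∘ r r′ (suc i) = refl

renP-renP : ∀ r r′ p → renP r (renP r′ p) ≡ renP (r ∘ r′) p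
renP-renP r r′ (var i)    = refl
renP-renP r r′ (lit n)    = refl
renP-renP r r′ (p ⊕ q)    = cong₂ _⊕_ (renP-renP r r′ p) (renP-renP r r′ q)
renP-renP r r′ (p ⊛ q)    = cong₂ _⊛_ (renP-renP r r′ p) (renP-renP r r′ q)
renP-renP r r′ (bin p n)  = cong (λ x → bin x n) (renP-renP r r′ p)
renP-renP r r′ (sumP p q) = cong₂ sumP (renP-renP r r′ p)
  (trans (renP-renP (ext r) (ext r′) q) (renP-cong (ext-∘ r r′) q))

exts-ext : ∀ σ r → exts σ ∘ ext r ≗ exts (σ ∘ r)
exts-ext σ r zero    = refl
exts-ext σ r (suc i) = refl

subP-renP : ∀ σ r p → subP σ (renP r p) ≡ subP (σ ∘ r) p
subP-renP σ r (var i)    = refl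
subP-renP σ r (lit n)    = refl
subP-renP σ r (p ⊕ q)    = cong₂ _⊕_ (subP-renP σ r p) (subP-renP σ r q)
subP-renP σ r (p ⊛ q)    = cong₂ _⊛_ (subP-renP σ r p) (subP-renP σ r q)
subP-renP σ r (bin p n)  = cong (λ x → bin x n) (subP-renP σ r p)
subP-renP σ r (sumP p q) = cong₂ sumP (subP-renP σ r p)
  (trans (subP-renP (exts σ) (ext r) q) (subP-cong (exts-ext σ r) q))

ext-exts : ∀ r σ → renP (ext r) ∘ exts σ ≗ exts (renP r ∘ σ)
ext-exts r σ zero    = refl
ext-exts r σ (suc i) = begin
  renP (ext r) (renP suc (σ i)) ≡⟨ renP-renP (ext r) suc (σ i) ⟩
  renP (suc ∘ r) (σ i)          ≡⟨ renP-renP suc r (σ i) ⟨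
  renP suc (renP r (σ i))       ∎

renP-subP : ∀ r σ p → renP r (subP σ p) ≡ subP (renP r ∘ σ) p
renP-subP r σ (var i)    = refl
renP-subP r σ (lit n)    = refl
renP-subP r σ (p ⊕ q)    = cong₂ _⊕_ (renP-subP r σ p) (renP-subP r σ q)
renP-subP r σ (p ⊛ q)    = cong₂ _⊛_ (renP-subP r σ p) (renP-subP r σ q)
renP-subP r σ (bin p n)  = cong (λ x → bin x n) (renP-subP r σ p)
renP-subP r σ (sumP p q) = cong₂ sumP (renP-subP r σ p)
  (trans (renP-subP (ext r) (exts σ) q) (subP-cong (ext-exts r σ) q))

subP-exts-wk : ∀ σ p → subP (exts σ) (renP suc p) ≡ renP suc (subP σ p)
subP-exts-wk σ p = trans (subP-renP (exts σ) suc p) (sym (renP-subP suc σ p))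

exts-∘ˢ : ∀ σ τ → exts σ ∘ˢ exts τ ≗ exts (σ ∘ˢ τ)
exts-∘ˢ σ τ zero    = refl
exts-∘ˢ σ τ (suc i) = subP-exts-wk σ (τ i)

extsN-∘ˢ : ∀ n σ τ → extsN n σ ∘ˢ extsN n τ ≗ extsN n (σ ∘ˢ τ)
extsN-∘ˢ zero    σ τ i = refl
extsN-∘ˢ (suc n) σ τ i =
  trans (exts-∘ˢ (extsN n σ) (extsN n τ) i) (exts-cong (extsN-∘ˢ n σ τ) i)

subP-subP : ∀ σ τ p → subP σ (subP τ p) ≡ subP (σ ∘ˢ τ) p
subP-subP σ τ (var i)    = refl
subP-subP σ τ (lit n)    = refl
subP-subP σ τ (p ⊕ q)    = cong₂ _⊕_ (subP-subP σ τ p) (subP-subP σ τ q)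
subP-subP σ τ (p ⊛ q)    = cong₂ _⊛_ (subP-subP σ τ p) (subP-subP σ τ q)
subP-subP σ τ (bin p n)  = cong (λ x → bin x n) (subP-subP σ τ p)
subP-subP σ τ (sumP p q) = cong₂ sumP (subP-subP σ τ p)
  (trans (subP-subP (exts σ) (exts τ) q) (subP-cong (exts-∘ˢ σ τ) q))

exts-var : exts var ≗ var
exts-var zero    = refl
exts-var (suc i) = refl

subP-var : ∀ p → subP var p ≡ p
subP-var (var i)    = refl
subP-var (lit n)    = refl
subP-var (p ⊕ q)    = cong₂ _⊕_ (subP-var p) (subP-var q)
subP-var (p ⊛ q)    = cong₂ _⊛_ (subP-var p) (subP-var q)
subP-var (bin p n)  = cong (λ x → bin x n) (subP-var p)
subP-var (sumP p q) = cong₂ sumP (subP-var p) (trans (subP-cong exts-var q) (subP-var q))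

exts-ren : ∀ r → exts (var ∘ r) ≗ var ∘ ext r
exts-ren r zero    = refl
exts-ren r (suc i) = refl

renP-as-subP : ∀ r p → renP r p ≡ subP (var ∘ r) p
renP-as-subP r (var i)    = refl
renP-as-subP r (lit n)    = refl
renP-as-subP r (p ⊕ q)    = cong₂ _⊕_ (renP-as-subP r p) (renP-as-subP r q)
renP-as-subP r (p ⊛ q)    = cong₂ _⊛_ (renP-as-subP r p) (renP-as-subP r q)
renP-as-subP r (bin p n)  = cong (λ x → bin x n) (renP-as-subP r p)
renP-as-subP r (sumP p q) = cong₂ sumP (renP-as-subP r p)
  (trans (renP-as-subP (ext r) q) (sym (subP-cong (exts-ren r) q)))

renP-id : ∀ p → renP (λ i → i) p ≡ p
renP-id p = trans (renP-as-subP (λ i → i) p) (subP-var p)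

⟦_⟧ˢ : Sub → Assignment → Assignment
⟦ σ ⟧ˢ ρ i = ⟦ σ i ⟧ ρ

sumBelow-cong : ∀ {n n′} {f g : ℕ → ℕ} → n ≡ n′ → f ≗ g → sumBelow n f ≡ sumBelow n′ g
sumBelow-cong {zero}  refl f≗g = refl
sumBelow-cong {suc n} refl f≗g = cong₂ _+_ (sumBelow-cong {n} refl f≗g) (f≗g n)

∷ₐ-cong : ∀ w {ρ ρ′} → ρ ≗ ρ′ → (w ∷ₐ ρ) ≗ (w ∷ₐ ρ′)
∷ₐ-cong w ρ≗ρ′ zero    = refl
∷ₐ-cong w ρ≗ρ′ (suc i) = ρ≗ρ′ i

⟦⟧-cong : ∀ {ρ ρ′} → ρ ≗ ρ′ → ∀ p → ⟦ p ⟧ ρ ≡ ⟦ p ⟧ ρ′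
⟦⟧-cong h (var i)    = h i
⟦⟧-cong h (lit n)    = refl
⟦⟧-cong h (p ⊕ q)    = cong₂ _+_ (⟦⟧-cong h p) (⟦⟧-cong h q)
⟦⟧-cong h (p ⊛ q)    = cong₂ _*_ (⟦⟧-cong h p) (⟦⟧-cong h q)
⟦⟧-cong h (bin p n)  = cong (_choose n) (⟦⟧-cong h p)
⟦⟧-cong h (sumP p q) = sumBelow-cong (⟦⟧-cong h p) (λ w → ⟦⟧-cong (∷ₐ-cong w h) q)

∷ₐ-ext : ∀ w ρ r → (w ∷ₐ ρ) ∘ ext r ≗ (w ∷ₐ (ρ ∘ r))
∷ₐ-ext w ρ r zero    = refl
∷ₐ-ext w ρ r (suc i) = refl

⟦⟧-renP : ∀ r ρ p → ⟦ renP r p ⟧ ρ ≡ ⟦ p ⟧ (ρ ∘ r)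
⟦⟧-renP r ρ (var i)    = refl
⟦⟧-renP r ρ (lit n)    = refl
⟦⟧-renP r ρ (p ⊕ q)    = cong₂ _+_ (⟦⟧-renP r ρ p) (⟦⟧-renP r ρ q)
⟦⟧-renP r ρ (p ⊛ q)    = cong₂ _*_ (⟦⟧-renP r ρ p) (⟦⟧-renP r ρ q)
⟦⟧-renP r ρ (bin p n)  = cong (_choose n) (⟦⟧-renP r ρ p)
⟦⟧-renP r ρ (sumP p q) = sumBelow-cong (⟦⟧-renP r ρ p)
  (λ w → trans (⟦⟧-renP (ext r) (w ∷ₐ ρ) q) (⟦⟧-cong (∷ₐ-ext w ρ r) q))

⟦⟧ˢ-exts : ∀ w σ ρ → ⟦ exts σ ⟧ˢ (w ∷ₐ ρ) ≗ (w ∷ₐ ⟦ σ ⟧ˢ ρ)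
⟦⟧ˢ-exts w σ ρ zero    = refl
⟦⟧ˢ-exts w σ ρ (suc i) = ⟦⟧-renP suc (w ∷ₐ ρ) (σ i)

⟦⟧-subP : ∀ σ ρ p → ⟦ subP σ p ⟧ ρ ≡ ⟦ p ⟧ (⟦ σ ⟧ˢ ρ)
⟦⟧-subP σ ρ (var i)    = refl
⟦⟧-subP σ ρ (lit n)    = refl
⟦⟧-subP σ ρ (p ⊕ q)    = cong₂ _+_ (⟦⟧-subP σ ρ p) (⟦⟧-subP σ ρ q)
⟦⟧-subP σ ρ (p ⊛ q)    = cong₂ _*_ (⟦⟧-subP σ ρ p) (⟦⟧-subP σ ρ q)
⟦⟧-subP σ ρ (bin p n)  = cong (_choose n) (⟦⟧-subP σ ρ p)
⟦⟧-subP σ ρ (sumP p q) = sumBelow-cong (⟦⟧-subP σ ρ p)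
  (λ w → trans (⟦⟧-subP (exts σ) (w ∷ₐ ρ) q) (⟦⟧-cong (⟦⟧ˢ-exts w σ ρ) q))

Holds-subC⁺ : ∀ σ ρ c → Holds (⟦ σ ⟧ˢ ρ) c → Holds ρ (subC σ c)
Holds-subC⁺ σ ρ (p ≤c q) = subst₂ _≤_ (sym (⟦⟧-subP σ ρ p)) (sym (⟦⟧-subP σ ρ q))

Holds-subC⁻ : ∀ σ ρ c → Holds ρ (subC σ c) → Holds (⟦ σ ⟧ˢ ρ) c
Holds-subC⁻ σ ρ (p ≤c q) = subst₂ _≤_ (⟦⟧-subP σ ρ p) (⟦⟧-subP σ ρ q)

⊨-subst : ∀ σ {Φ} c → Φ ⊨ c → subCs σ Φ ⊨ subC σ c
⊨-subst σ c Φ⊨c ρ ρ⊨σΦ =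
  Holds-subC⁺ σ ρ c (Φ⊨c (⟦ σ ⟧ˢ ρ) (All.map (Holds-subC⁻ σ ρ _) (map⁻ ρ⊨σΦ)))

⊨*-subst : ∀ σ {Φ Ψ} → Φ ⊨* Ψ → subCs σ Φ ⊨* subCs σ Ψ
⊨*-subst σ Φ⊨Ψ = map⁺ (All.map (λ {c} → ⊨-subst σ c) Φ⊨Ψ)

subC-cong : ∀ {σ σ′} → σ ≗ σ′ → ∀ c → subC σ c ≡ subC σ′ c
subC-cong h (p ≤c q) = cong₂ _≤c_ (subP-cong h p) (subP-cong h q)

subCs-cong : ∀ {σ σ′} → σ ≗ σ′ → ∀ Φ → subCs σ Φ ≡ subCs σ′ Φ
subCs-cong h = map-cong (subC-cong h)

subF-cong : ∀ {σ σ′} → σ ≗ σ′ → ∀ A → subF σ A ≡ subF σ′ A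
subF-cong h (atom k a ps) = cong (atom k a) (Vecₚ.map-cong (subP-cong h) ps)
subF-cong h (A ⊗ B)       = cong₂ _⊗_ (subF-cong h A) (subF-cong h B)
subF-cong h (A ⊸ B)       = cong₂ _⊸_ (subF-cong h A) (subF-cong h B)
subF-cong h (∀α k A)      = cong (∀α k) (subF-cong h A)
subF-cong h (! p A)       = cong₂ ! (subP-cong h p) (subF-cong (exts-cong h) A)
subF-cong h (∀x n Φ A)    =
  cong₂ (∀x n) (subCs-cong (extsN-cong n h) Φ) (subF-cong (extsN-cong n h) A)
subF-cong h (∃x n Φ A)    =
  cong₂ (∃x n) (subCs-cong (extsN-cong n h) Φ) (subF-cong (extsN-cong n h) A)

subC-subC : ∀ σ τ c → subC σ (subC τ c) ≡ subC (σ ∘ˢ τ) c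
subC-subC σ τ (p ≤c q) = cong₂ _≤c_ (subP-subP σ τ p) (subP-subP σ τ q)

subCs-subCs : ∀ σ τ Φ → subCs σ (subCs τ Φ) ≡ subCs (σ ∘ˢ τ) Φ
subCs-subCs σ τ Φ = trans (sym (map-∘ Φ)) (map-cong (subC-subC σ τ) Φ)

subF-subF : ∀ σ τ A → subF σ (subF τ A) ≡ subF (σ ∘ˢ τ) A
subF-subF σ τ (atom k a ps) =
  cong (atom k a) (trans (sym (Vecₚ.map-∘ (subP σ) (subP τ) ps))
                         (Vecₚ.map-cong (subP-subP σ τ) ps))
subF-subF σ τ (A ⊗ B)    = cong₂ _⊗_ (subF-subF σ τ A) (subF-subF σ τ B)
subF-subF σ τ (A ⊸ B)    = cong₂ _⊸_ (subF-subF σ τ A) (subF-subF σ τ B)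
subF-subF σ τ (∀α k A)   = cong (∀α k) (subF-subF σ τ A)
subF-subF σ τ (! p A)    = cong₂ ! (subP-subP σ τ p)
  (trans (subF-subF (exts σ) (exts τ) A) (subF-cong (exts-∘ˢ σ τ) A))
subF-subF σ τ (∀x n Φ A) = cong₂ (∀x n)
  (trans (subCs-subCs (extsN n σ) (extsN n τ) Φ) (subCs-cong (extsN-∘ˢ n σ τ) Φ))
  (trans (subF-subF (extsN n σ) (extsN n τ) A) (subF-cong (extsN-∘ˢ n σ τ) A))
subF-subF σ τ (∃x n Φ A) = cong₂ (∃x n)
  (trans (subCs-subCs (extsN n σ) (extsN n τ) Φ) (subCs-cong (extsN-∘ˢ n σ τ) Φ))
  (trans (subF-subF (extsN n σ) (extsN n τ) A) (subF-cong (extsN-∘ˢ n σ τ) A))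

subF-comm : ∀ {σ₁ τ₁ σ₂ τ₂} → σ₁ ∘ˢ τ₁ ≗ σ₂ ∘ˢ τ₂ →
            ∀ A → subF σ₁ (subF τ₁ A) ≡ subF σ₂ (subF τ₂ A)
subF-comm {σ₁} {τ₁} {σ₂} {τ₂} h A = begin
  subF σ₁ (subF τ₁ A) ≡⟨ subF-subF σ₁ τ₁ A ⟩
  subF (σ₁ ∘ˢ τ₁) A   ≡⟨ subF-cong h A ⟩
  subF (σ₂ ∘ˢ τ₂) A   ≡⟨ subF-subF σ₂ τ₂ A ⟨
  subF σ₂ (subF τ₂ A) ∎

subCs-comm : ∀ {σ₁ τ₁ σ₂ τ₂} → σ₁ ∘ˢ τ₁ ≗ σ₂ ∘ˢ τ₂ →
             ∀ Φ → subCs σ₁ (subCs τ₁ Φ) ≡ subCs σ₂ (subCs τ₂ Φ)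
subCs-comm {σ₁} {τ₁} {σ₂} {τ₂} h Φ = begin
  subCs σ₁ (subCs τ₁ Φ) ≡⟨ subCs-subCs σ₁ τ₁ Φ ⟩
  subCs (σ₁ ∘ˢ τ₁) Φ    ≡⟨ subCs-cong h Φ ⟩
  subCs (σ₂ ∘ˢ τ₂) Φ    ≡⟨ subCs-subCs σ₂ τ₂ Φ ⟨
  subCs σ₂ (subCs τ₂ Φ) ∎

extsN-+ : ∀ n σ m → extsN n σ (n + m) ≡ renP (n +_) (σ m)
extsN-+ zero    σ m = sym (renP-id (σ m))
extsN-+ (suc n) σ m = trans (cong (renP suc) (extsN-+ n σ m)) (renP-renP suc (n +_) (σ m))

extsN-bound : ∀ n σ (i : Fin n) → extsN n σ (toℕ i) ≡ var (toℕ i)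
extsN-bound (suc n) σ Fin.zero    = refl
extsN-bound (suc n) σ (Fin.suc i) = cong (renP suc) (extsN-bound n σ i)

subP-extsN-shift : ∀ n σ r → subP (extsN n σ) (renP (n +_) r) ≡ renP (n +_) (subP σ r)
subP-extsN-shift n σ r = begin
  subP (extsN n σ) (renP (n +_) r) ≡⟨ subP-renP (extsN n σ) (n +_) r ⟩
  subP (extsN n σ ∘ (n +_)) r      ≡⟨ subP-cong (extsN-+ n σ) r ⟩
  subP (renP (n +_) ∘ σ) r         ≡⟨ renP-subP (n +_) σ r ⟨
  renP (n +_) (subP σ r)           ∎

extsN-wkSub : ∀ n σ → extsN n σ ∘ˢ wkSub n ≗ wkSub n ∘ˢ σ
extsN-wkSub n σ m = trans (extsN-+ n σ m) (renP-as-subP (n +_) (σ m))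

subCs-wkCs : ∀ n σ Φ → subCs (extsN n σ) (wkCs n Φ) ≡ wkCs n (subCs σ Φ)
subCs-wkCs n σ = subCs-comm (extsN-wkSub n σ)

subF-wkF : ∀ n σ A → subF (extsN n σ) (wkF n A) ≡ wkF n (subF σ A)
subF-wkF n σ = subF-comm (extsN-wkSub n σ)

map-subF-wkF : ∀ n σ Γ → map (subF (extsN n σ)) (map (wkF n) Γ) ≡ map (wkF n) (map (subF σ) Γ)
map-subF-wkF n σ Γ = trans (sym (map-∘ Γ)) (trans (map-cong (subF-wkF n σ) Γ) (map-∘ Γ))

subCs-binder : ∀ n σ Φ Θ →
  subCs (extsN n σ) (wkCs n Φ ++ Θ) ≡ wkCs n (subCs σ Φ) ++ subCs (extsN n σ) Θ
subCs-binder n σ Φ Θ =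
  trans (map-++ (subC (extsN n σ)) (wkCs n Φ) Θ) (cong (_++ _) (subCs-wkCs n σ Φ))

subCs-!binder : ∀ σ Φ q →
  subCs (exts σ) (wkCs 1 Φ ++ (var 0 <c renP suc q) ∷ [])
    ≡ wkCs 1 (subCs σ Φ) ++ (var 0 <c renP suc (subP σ q)) ∷ []
subCs-!binder σ Φ q =
  trans (subCs-binder 1 σ Φ _) (cong (λ b → _ ++ (var 0 <c b) ∷ []) (subP-exts-wk σ q))

PolyLE-subst : ∀ σ {Φ k} {ps qs : Vec Poly k} → PolyLE Φ ps qs →
               PolyLE (subCs σ Φ) (Vec.map (subP σ) ps) (Vec.map (subP σ) qs)
PolyLE-subst σ []       = []
PolyLE-subst σ (_∷_ {p = p} {q} h hs) = ⊨-subst σ (p ≤c q) h ∷ PolyLE-subst σ hs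

≤-subst : ∀ σ {Φ A B} → A ≤[ Φ ] B → subF σ A ≤[ subCs σ Φ ] subF σ B
≤-subst σ (atom≤ h)  = atom≤ (PolyLE-subst σ h)
≤-subst σ (⊗≤ h h′)  = ⊗≤ (≤-subst σ h) (≤-subst σ h′)
≤-subst σ (⊸≤ h h′)  = ⊸≤ (≤-subst σ h) (≤-subst σ h′)
≤-subst σ (∀α≤ h)    = ∀α≤ (≤-subst σ h)
≤-subst σ (!≤ {Φ} {p} {q} h le) =
  !≤ (⊨-subst σ (q ≤c p) h) (subst (_ ≤[_] _) (subCs-!binder σ Φ q) (≤-subst (exts σ) le))
≤-subst σ (∀x≤ {Φ} {n} {Θ = Θ} h le) =
  ∀x≤ (subst (_⊨* _) (subCs-binder n σ Φ Θ) (⊨*-subst (extsN n σ) h))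
      (subst (_ ≤[_] _) (subCs-binder n σ Φ Θ) (≤-subst (extsN n σ) le))
≤-subst σ (∃x≤ {Φ} {n} {Ψ} h le) =
  ∃x≤ (subst (_⊨* _) (subCs-binder n σ Φ Ψ) (⊨*-subst (extsN n σ) h))
      (subst (_ ≤[_] _) (subCs-binder n σ Φ Ψ) (≤-subst (extsN n σ) le))

Bounded-subst : ∀ σ n Φ → Bounded n Φ → Bounded n (subCs (extsN n σ) Φ)
Bounded-subst σ n Φ bounded i =
  let r , Φ⊨i≤r = bounded i
  in subP σ r , subst (subCs (extsN n σ) Φ ⊨_)
                       (cong₂ _≤c_ (extsN-bound n σ i) (subP-extsN-shift n σ r))
                       (⊨-subst (extsN n σ) (var (toℕ i) ≤c renP (n +_) r) Φ⊨i≤r)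

WF-subst : ∀ σ A → WF A → WF (subF σ A)
WF-subst σ (atom k a ps) w       = tt
WF-subst σ (A ⊗ B)       (w , v) = WF-subst σ A w , WF-subst σ B v
WF-subst σ (A ⊸ B)       (w , v) = WF-subst σ A w , WF-subst σ B v
WF-subst σ (∀α k A)      w       = WF-subst σ A w
WF-subst σ (! p A)       w       = WF-subst (exts σ) A w
WF-subst σ (∀x n Φ A)    (b , w) = Bounded-subst σ n Φ b , WF-subst (extsN n σ) A w
WF-subst σ (∃x n Φ A)    (b , w) = Bounded-subst σ n Φ b , WF-subst (extsN n σ) A w

PreservesOcc : ℕ → Sub → Set
PreservesOcc j σ = ∀ m → occP j (σ m) ≡ (j ≡ᵇ m)

occP-renP : ∀ j j′ r → (∀ m → (j′ ≡ᵇ r m) ≡ (j ≡ᵇ m)) → ∀ p → occP j′ (renP r p) ≡ occP j p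
occP-renP j j′ r h (var m)    = h m
occP-renP j j′ r h (lit n)    = refl
occP-renP j j′ r h (p ⊕ q)    = cong₂ _∨_ (occP-renP j j′ r h p) (occP-renP j j′ r h q)
occP-renP j j′ r h (p ⊛ q)    = cong₂ _∨_ (occP-renP j j′ r h p) (occP-renP j j′ r h q)
occP-renP j j′ r h (bin p n)  = occP-renP j j′ r h p
occP-renP j j′ r h (sumP p q) = cong₂ _∨_ (occP-renP j j′ r h p)
  (occP-renP (suc j) (suc j′) (ext r) (λ { zero → refl ; (suc m) → h m }) q)

occP-renP-miss : ∀ j r → (∀ m → (j ≡ᵇ r m) ≡ false) → ∀ p → occP j (renP r p) ≡ false
occP-renP-miss j r h (var m)    = h m
occP-renP-miss j r h (lit n)    = refl
occP-renP-miss j r h (p ⊕ q)    = cong₂ _∨_ (occP-renP-miss j r h p) (occP-renP-miss j r h q)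
occP-renP-miss j r h (p ⊛ q)    = cong₂ _∨_ (occP-renP-miss j r h p) (occP-renP-miss j r h q)
occP-renP-miss j r h (bin p n)  = occP-renP-miss j r h p
occP-renP-miss j r h (sumP p q) = cong₂ _∨_ (occP-renP-miss j r h p)
  (occP-renP-miss (suc j) (ext r) (λ { zero → refl ; (suc m) → h m }) q)

PreservesOcc-exts : ∀ {j σ} → PreservesOcc j σ → PreservesOcc (suc j) (exts σ)
PreservesOcc-exts h zero    = refl
PreservesOcc-exts {j} {σ} h (suc m) = trans (occP-renP j (suc j) suc (λ _ → refl) (σ m)) (h m)

PreservesOcc-extsN : ∀ {j σ} → PreservesOcc j σ → ∀ n → PreservesOcc (n + j) (extsN n σ)
PreservesOcc-extsN h zero    = h
PreservesOcc-extsN h (suc n) = PreservesOcc-exts (PreservesOcc-extsN h n)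

PreservesOcc-bound : ∀ n σ (i : Fin n) → PreservesOcc (toℕ i) (extsN n σ)
PreservesOcc-bound (suc n) σ Fin.zero    zero    = refl
PreservesOcc-bound (suc n) σ Fin.zero    (suc m) = occP-renP-miss 0 suc (λ _ → refl) (extsN n σ m)
PreservesOcc-bound (suc n) σ (Fin.suc i)         = PreservesOcc-exts (PreservesOcc-bound n σ i)

occP-subP : ∀ {j σ} → PreservesOcc j σ → ∀ p → occP j (subP σ p) ≡ occP j p
occP-subP h (var m)    = h m
occP-subP h (lit n)    = refl
occP-subP h (p ⊕ q)    = cong₂ _∨_ (occP-subP h p) (occP-subP h q)
occP-subP h (p ⊛ q)    = cong₂ _∨_ (occP-subP h p) (occP-subP h q)
occP-subP h (bin p n)  = occP-subP h p
occP-subP h (sumP p q) = cong₂ _∨_ (occP-subP h p) (occP-subP (PreservesOcc-exts h) q)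

anyV-occP-subP : ∀ {j σ} → PreservesOcc j σ →
                 ∀ {k} (ps : Vec Poly k) → anyV (occP j) (Vec.map (subP σ) ps) ≡ anyV (occP j) ps
anyV-occP-subP h []       = refl
anyV-occP-subP h (p ∷ ps) = cong₂ _∨_ (occP-subP h p) (anyV-occP-subP h ps)

posC-subCs : ∀ {j σ} → PreservesOcc j σ → ∀ Φ → posC j (subCs σ Φ) ≡ posC j Φ
posC-subCs h []             = refl
posC-subCs h ((p ≤c q) ∷ Φ) = cong₂ _∨_ (occP-subP h q) (posC-subCs h Φ)

negC-subCs : ∀ {j σ} → PreservesOcc j σ → ∀ Φ → negC j (subCs σ Φ) ≡ negC j Φ
negC-subCs h []             = refl
negC-subCs h ((p ≤c q) ∷ Φ) = cong₂ _∨_ (occP-subP h p) (negC-subCs h Φ)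

posOcc-subF : ∀ {j σ} → PreservesOcc j σ → ∀ A → posOcc j (subF σ A) ≡ posOcc j A
negOcc-subF : ∀ {j σ} → PreservesOcc j σ → ∀ A → negOcc j (subF σ A) ≡ negOcc j A

posOcc-subF h (atom k a ps) = anyV-occP-subP h ps
posOcc-subF h (A ⊗ B)       = cong₂ _∨_ (posOcc-subF h A) (posOcc-subF h B)
posOcc-subF h (A ⊸ B)       = cong₂ _∨_ (negOcc-subF h A) (posOcc-subF h B)
posOcc-subF h (∀α k A)      = posOcc-subF h A
posOcc-subF h (! p A)       = posOcc-subF (PreservesOcc-exts h) A
posOcc-subF h (∀x n Φ A)    = let h′ = PreservesOcc-extsN h n in
  cong₂ _∨_ (negC-subCs h′ Φ) (posOcc-subF h′ A)
posOcc-subF h (∃x n Φ A)    = let h′ = PreservesOcc-extsN h n in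
  cong₂ _∨_ (posC-subCs h′ Φ) (posOcc-subF h′ A)

negOcc-subF h (atom k a ps) = refl
negOcc-subF h (A ⊗ B)       = cong₂ _∨_ (negOcc-subF h A) (negOcc-subF h B)
negOcc-subF h (A ⊸ B)       = cong₂ _∨_ (posOcc-subF h A) (negOcc-subF h B)
negOcc-subF h (∀α k A)      = negOcc-subF h A
negOcc-subF h (! p A)       = cong₂ _∨_ (occP-subP h p) (negOcc-subF (PreservesOcc-exts h) A)
negOcc-subF h (∀x n Φ A)    = let h′ = PreservesOcc-extsN h n in
  cong₂ _∨_ (posC-subCs h′ Φ) (negOcc-subF h′ A)
negOcc-subF h (∃x n Φ A)    = let h′ = PreservesOcc-extsN h n in
  cong₂ _∨_ (negC-subCs h′ Φ) (negOcc-subF h′ A)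

subF-renα : ∀ σ r A → subF σ (renα r A) ≡ renα r (subF σ A)
subF-renα σ r (atom k a ps) = refl
subF-renα σ r (A ⊗ B)       = cong₂ _⊗_ (subF-renα σ r A) (subF-renα σ r B)
subF-renα σ r (A ⊸ B)       = cong₂ _⊸_ (subF-renα σ r A) (subF-renα σ r B)
subF-renα σ r (∀α k A)      = cong (∀α k) (subF-renα σ (liftr k r) A)
subF-renα σ r (! p A)       = cong (! _) (subF-renα (exts σ) r A)
subF-renα σ r (∀x n Φ A)    = cong (∀x n _) (subF-renα (extsN n σ) r A)
subF-renα σ r (∃x n Φ A)    = cong (∃x n _) (subF-renα (extsN n σ) r A)

subF-idT : ∀ k a σ → subF (extsN k σ) (idT k a) ≡ idT k a
subF-idT k a σ = cong (atom k a)
  (trans (sym (Vecₚ.tabulate-∘ (subP (extsN k σ)) _)) (Vecₚ.tabulate-cong (extsN-bound k σ)))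

-- σ acting on a template of arity k leaves its k argument variables alone
subTmpl : Sub → Tmpl → Tmpl
subTmpl σ τ k a = subF (extsN k σ) (τ k a)

liftτ-cong : ∀ k′ {τ τ′ : Tmpl} → (∀ k a → τ k a ≡ τ′ k a) → ∀ k a → liftτ k′ τ k a ≡ liftτ k′ τ′ k a
liftτ-cong k′ h k zero with k ≡ᵇ k′
... | true  = refl
... | false = cong (shiftα k′) (h k zero)
liftτ-cong k′ h k (suc a) with k ≡ᵇ k′
... | true  = cong (shiftα k′) (h k a)
... | false = cong (shiftα k′) (h k (suc a))

subα-cong : ∀ {τ τ′ : Tmpl} → (∀ k a → τ k a ≡ τ′ k a) → ∀ A → subα τ A ≡ subα τ′ A
subα-cong h (atom k a ps) = cong (subF (instV ps)) (h k a)
subα-cong h (A ⊗ B)       = cong₂ _⊗_ (subα-cong h A) (subα-cong h B)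
subα-cong h (A ⊸ B)       = cong₂ _⊸_ (subα-cong h A) (subα-cong h B)
subα-cong h (∀α k A)      = cong (∀α k) (subα-cong (liftτ-cong k h) A)
subα-cong h (! p A)       = cong (! p) (subα-cong (λ k a → cong (subF _) (h k a)) A)
subα-cong h (∀x n Φ A)    = cong (∀x n Φ) (subα-cong (λ k a → cong (subF _) (h k a)) A)
subα-cong h (∃x n Φ A)    = cong (∃x n Φ) (subα-cong (λ k a → cong (subF _) (h k a)) A)

liftτ-subTmpl : ∀ k′ σ τ k a → subTmpl σ (liftτ k′ τ) k a ≡ liftτ k′ (subTmpl σ τ) k a
liftτ-subTmpl k′ σ τ k zero with k ≡ᵇ k′
... | true  = subF-idT k zero σ
... | false = subF-renα _ _ (τ k zero)
liftτ-subTmpl k′ σ τ k (suc a) with k ≡ᵇ k′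
... | true  = subF-renα _ _ (τ k a)
... | false = subF-renα _ _ (τ k (suc a))

instV-comm : ∀ {k} σ (ps : Vec Poly k) → σ ∘ˢ instV ps ≗ instV (Vec.map (subP σ) ps) ∘ˢ extsN k σ
instV-comm σ []       m = sym (subP-var (σ m))
instV-comm σ (p ∷ ps) zero    = refl
instV-comm {suc k} σ (p ∷ ps) (suc m) =
  trans (instV-comm σ ps m) (sym (subP-renP (instV (Vec.map (subP σ) (p ∷ ps))) suc (extsN k σ m)))

extsN-wk-comm : ∀ n k σ T → subF (extsN k (extsN n σ)) (subF (extsN k (wkSub n)) T)
                          ≡ subF (extsN k (wkSub n)) (subF (extsN k σ) T)
extsN-wk-comm n k σ = subF-comm λ i → begin
  (extsN k (extsN n σ) ∘ˢ extsN k (wkSub n)) i ≡⟨ extsN-∘ˢ k _ _ i ⟩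
  extsN k (extsN n σ ∘ˢ wkSub n) i             ≡⟨ extsN-cong k (extsN-wkSub n σ) i ⟩
  extsN k (wkSub n ∘ˢ σ) i                     ≡⟨ extsN-∘ˢ k _ _ i ⟨
  (extsN k (wkSub n) ∘ˢ extsN k σ) i           ∎

subF-subα : ∀ σ τ A → subF σ (subα τ A) ≡ subα (subTmpl σ τ) (subF σ A)
subF-subα σ τ (atom k a ps) = subF-comm (instV-comm σ ps) (τ k a)
subF-subα σ τ (A ⊗ B)  = cong₂ _⊗_ (subF-subα σ τ A) (subF-subα σ τ B)
subF-subα σ τ (A ⊸ B)  = cong₂ _⊸_ (subF-subα σ τ A) (subF-subα σ τ B)
subF-subα σ τ (∀α k A) = cong (∀α k)
  (trans (subF-subα σ (liftτ k τ) A) (subα-cong (liftτ-subTmpl k σ τ) (subF σ A)))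
subF-subα σ τ (! p A) = cong (! _)
  (trans (subF-subα (exts σ) _ A)
         (subα-cong (λ k a → extsN-wk-comm 1 k σ (τ k a)) (subF (exts σ) A)))
subF-subα σ τ (∀x n Φ A) = cong (∀x n _)
  (trans (subF-subα (extsN n σ) _ A)
         (subα-cong (λ k a → extsN-wk-comm n k σ (τ k a)) (subF (extsN n σ) A)))
subF-subα σ τ (∃x n Φ A) = cong (∃x n _)
  (trans (subF-subα (extsN n σ) _ A)
         (subα-cong (λ k a → extsN-wk-comm n k σ (τ k a)) (subF (extsN n σ) A)))

instα-subTmpl : ∀ k B σ k′ a → subTmpl σ (instα k B) k′ a ≡ instα k (subF (extsN k σ) B) k′ a
instα-subTmpl k B σ k′ zero with k′ ≡ᵇ k in k′≡ᵇk
... | true  = cong (λ m → subF (extsN m σ) B) (≡ᵇ⇒≡ k′ k (subst T (sym k′≡ᵇk) tt))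
... | false = subF-idT k′ zero σ
instα-subTmpl k B σ k′ (suc a) with k′ ≡ᵇ k
... | true  = subF-idT k′ a σ
... | false = subF-idT k′ (suc a) σ

subF-instα : ∀ σ k A B → subF σ (A [ B /α k ]) ≡ (subF σ A) [ subF (extsN k σ) B /α k ]
subF-instα σ k A B = trans (subF-subα σ (instα k B) A) (subα-cong (instα-subTmpl k B σ) (subF σ A))

subXp-comm : ∀ σ p → exts σ ∘ˢ subXp p ≗ subXp (subP σ p) ∘ˢ exts σ
subXp-comm σ p zero    = cong (_⊕ var zero) (subP-exts-wk σ p)
subXp-comm σ p (suc m) =
  trans (renP-as-subP suc (σ m)) (sym (subP-renP (subXp (subP σ p)) suc (σ m)))

sub1-comm : ∀ σ → σ ∘ˢ sub1 (lit 1) ≗ sub1 (lit 1) ∘ˢ exts σ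
sub1-comm σ zero    = refl
sub1-comm σ (suc m) = sym (trans (subP-renP (sub1 (lit 1)) suc (σ m)) (subP-var (σ m)))

exts³-renQ : ∀ σ → exts (exts (exts σ)) ∘ renQ ≗ renP renQ ∘ exts σ
exts³-renQ σ zero    = refl
exts³-renQ σ (suc j) = begin
  renP suc (renP suc (renP suc (σ j))) ≡⟨ cong (renP suc) (renP-renP suc suc (σ j)) ⟩
  renP suc (renP (suc ∘ suc) (σ j))    ≡⟨ renP-renP suc (suc ∘ suc) (σ j) ⟩
  renP (renQ ∘ suc) (σ j)              ≡⟨ renP-renP renQ suc (σ j) ⟨
  renP renQ (renP suc (σ j))           ∎

subN-comm : ∀ σ q → exts (exts σ) ∘ˢ subN q ≗ subN (subP (exts σ) q) ∘ˢ exts σ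
subN-comm σ q zero = cong (λ s → var 0 ⊕ sumP (var 1) s) (begin
  subP (exts (exts (exts σ))) (renP renQ q) ≡⟨ subP-renP _ renQ q ⟩
  subP (exts (exts (exts σ)) ∘ renQ) q      ≡⟨ subP-cong (exts³-renQ σ) q ⟩
  subP (renP renQ ∘ exts σ) q               ≡⟨ renP-subP renQ (exts σ) q ⟨
  renP renQ (subP (exts σ) q)               ∎)
subN-comm σ q (suc m) = begin
  renP suc (renP suc (σ m))                        ≡⟨ renP-renP suc suc (σ m) ⟩
  renP (suc ∘ suc) (σ m)                           ≡⟨ renP-as-subP _ (σ m) ⟩
  subP (var ∘ suc ∘ suc) (σ m)                     ≡⟨ subP-renP (subN (subP (exts σ) q)) suc (σ m) ⟨
  subP (subN (subP (exts σ) q)) (renP suc (σ m))   ∎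

eraseF-subF : ∀ σ A → eraseF (subF σ A) ≡ eraseF A
eraseF-subF σ (atom k a ps) = refl
eraseF-subF σ (A ⊗ B)       = cong₂ _∧₂_ (eraseF-subF σ A) (eraseF-subF σ B)
eraseF-subF σ (A ⊸ B)       = cong₂ _⇒₂_ (eraseF-subF σ A) (eraseF-subF σ B)
eraseF-subF σ (∀α k A)      = cong (∀₂ k) (eraseF-subF σ A)
eraseF-subF σ (! p A)       = eraseF-subF (exts σ) A
eraseF-subF σ (∀x n Φ A)    = eraseF-subF (extsN n σ) A
eraseF-subF σ (∃x n Φ A)    = eraseF-subF (extsN n σ) A

map-eraseF-subF : ∀ σ Γ → map eraseF (map (subF σ) Γ) ≡ map eraseF Γ
map-eraseF-subF σ Γ = trans (sym (map-∘ Γ)) (map-cong (eraseF-subF σ) Γ)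

Erasing : ConSet → List Form → Form → Proof₂ → Set
Erasing Φ Γ B t = Σ (Φ ⨾ Γ ⊢ B) (λ π → ⌊ π ⌋ ≡ t)

castErasing : ∀ {Φ Φ′ Γ Γ′ B B′ t} → Φ ≡ Φ′ → Γ ≡ Γ′ → B ≡ B′ → Erasing Φ Γ B t → Erasing Φ′ Γ′ B′ t
castErasing refl refl refl d = d

erase-node : ∀ r σ Γ B {Γ′ cs′ cs} → Γ′ ≡ map (subF σ) Γ → cs′ ≡ cs →
             node r (map eraseF Γ′) (eraseF (subF σ B)) cs′ ≡ node r (map eraseF Γ) (eraseF B) cs
erase-node r σ Γ B refl refl =
  cong₂ (λ Γ₂ B₂ → node r Γ₂ B₂ _) (map-eraseF-subF σ Γ) (eraseF-subF σ B)

record Substituted (σ : Sub) {Φ Γ B} (π : Φ ⨾ Γ ⊢ B) : Set where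
  constructor ⟪_⟫
  field erasing : Erasing (subCs σ Φ) (map (subF σ) Γ) (subF σ B) ⌊ π ⌋

module _ (σ : Sub) where

  Ax-subst : ∀ {Φ A B} (A≤B : A ≤[ Φ ] B) → Substituted σ (Ax A≤B)
  Ax-subst {A = A} {B} A≤B =
    ⟪ Ax (≤-subst σ A≤B) , erase-node axiom σ (A ∷ []) B refl refl ⟫

  Cut-subst : ∀ {Φ Γ Δ A B π₁ π₂} (w : WF A) → Substituted σ π₁ → Substituted σ π₂ →
              Substituted σ (Cut {Φ} {Γ} {Δ} {A} {B} w π₁ π₂)
  Cut-subst {Γ = Γ} {Δ} {A} {B} w ⟪ π₁′ , e₁ ⟫ ⟪ π₂′ , e₂ ⟫ = ⟪ castErasing refl split refl
    (Cut (WF-subst σ A w) π₁′ π₂′ , erase-node cut σ (Γ ++ Δ) B split (cong₂ _∷_ e₁ (cong [_] e₂))) ⟫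
    where
    split : map (subF σ) Γ ++ map (subF σ) Δ ≡ map (subF σ) (Γ ++ Δ)
    split = sym (map-++ (subF σ) Γ Δ)

  Wk-subst : ∀ {Φ Γ A B π} → Substituted σ π → Substituted σ (Wk {Φ} {Γ} {A} {B} π)
  Wk-subst {Γ = Γ} {A} {B} ⟪ π′ , e ⟫ =
    ⟪ Wk π′ , erase-node weakening σ (A ∷ Γ) B refl (cong [_] e) ⟫

  Exch-subst : ∀ {Φ} Γ {A B Δ C π} → Substituted σ π →
               Substituted σ (Exch {Φ} Γ {A} {B} {Δ} {C} π)
  Exch-subst Γ {A} {B} {Δ} {C} ⟪ πσ ⟫ =
    let π′ , e = castErasing refl (map-++ (subF σ) Γ (A ∷ B ∷ Δ)) refl πσ
    in ⟪ castErasing refl split refl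
           (Exch (map (subF σ) Γ) π′
           , erase-node exchange σ (Γ ++ B ∷ A ∷ Δ) C split (cong [_] e)) ⟫
    where
    split : map (subF σ) Γ ++ subF σ B ∷ subF σ A ∷ map (subF σ) Δ ≡ map (subF σ) (Γ ++ B ∷ A ∷ Δ)
    split = sym (map-++ (subF σ) Γ (B ∷ A ∷ Δ))

  Ctr-subst : ∀ {Φ Γ p q r A B π} (p+q⊑r : (p ⊕ q) ⊑[ Φ ] r) →
              Substituted σ π → Substituted σ (Ctr {Φ} {Γ} {p} {q} {r} {A} {B} π p+q⊑r)
  Ctr-subst {Γ = Γ} {p} {q} {r} {A} {B} p+q⊑r ⟪ πσ ⟫ =
    let π′ , e = castErasing refl (cong (λ A′ → subF σ (! p A) ∷ ! (subP σ q) A′ ∷ map (subF σ) Γ)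
                                        shifted) refl πσ
    in ⟪ Ctr π′ (⊨-subst σ ((p ⊕ q) ≤c r) p+q⊑r)
       , erase-node contraction σ (! r A ∷ Γ) B refl (cong [_] e) ⟫
    where
    shifted : subF (exts σ) (subF (subXp p) A) ≡ subF (subXp (subP σ p)) (subF (exts σ) A)
    shifted = subF-comm (subXp-comm σ p) A

  R⊸-subst : ∀ {Φ Γ A B π} → Substituted σ π → Substituted σ (R⊸ {Φ} {Γ} {A} {B} π)
  R⊸-subst {Γ = Γ} {A} {B} ⟪ π′ , e ⟫ =
    ⟪ R⊸ π′ , erase-node R⇒ σ Γ (A ⊸ B) refl (cong [_] e) ⟫

  L⊸-subst : ∀ {Φ Γ Δ A B C π₁ π₂} → Substituted σ π₁ → Substituted σ π₂ →
             Substituted σ (L⊸ {Φ} {Γ} {Δ} {A} {B} {C} π₁ π₂)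
  L⊸-subst {Γ = Γ} {Δ} {A} {B} {C} ⟪ π₁′ , e₁ ⟫ ⟪ π₂′ , e₂ ⟫ = ⟪ castErasing refl split refl
    (L⊸ π₁′ π₂′ , erase-node L⇒ σ ((A ⊸ B) ∷ Γ ++ Δ) C split (cong₂ _∷_ e₁ (cong [_] e₂))) ⟫
    where
    split : subF σ (A ⊸ B) ∷ map (subF σ) Γ ++ map (subF σ) Δ ≡ map (subF σ) ((A ⊸ B) ∷ Γ ++ Δ)
    split = cong (_ ∷_) (sym (map-++ (subF σ) Γ Δ))

  R⊗-subst : ∀ {Φ Γ Δ A B π₁ π₂} → Substituted σ π₁ → Substituted σ π₂ →
             Substituted σ (R⊗ {Φ} {Γ} {Δ} {A} {B} π₁ π₂)
  R⊗-subst {Γ = Γ} {Δ} {A} {B} ⟪ π₁′ , e₁ ⟫ ⟪ π₂′ , e₂ ⟫ = ⟪ castErasing refl split refl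
    (R⊗ π₁′ π₂′ , erase-node R∧ σ (Γ ++ Δ) (A ⊗ B) split (cong₂ _∷_ e₁ (cong [_] e₂))) ⟫
    where
    split : map (subF σ) Γ ++ map (subF σ) Δ ≡ map (subF σ) (Γ ++ Δ)
    split = sym (map-++ (subF σ) Γ Δ)

  L⊗-subst : ∀ {Φ Γ A B C π} → Substituted σ π → Substituted σ (L⊗ {Φ} {Γ} {A} {B} {C} π)
  L⊗-subst {Γ = Γ} {A} {B} {C} ⟪ π′ , e ⟫ =
    ⟪ L⊗ π′ , erase-node L∧ σ ((A ⊗ B) ∷ Γ) C refl (cong [_] e) ⟫

  P!-subst : ∀ {Φ Ψ p B} qAs {π} (Φ-holds : wkCs 1 Ψ ++ (var 0 <c renP suc p) ∷ [] ⊨* Φ)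
             (p⊑qs : All (λ qA → p ⊑[ Ψ ] proj₁ qA) qAs) →
             Substituted (exts σ) π → Substituted σ (P! {Φ} {Ψ} {p} {B} qAs π Φ-holds p⊑qs)
  P!-subst {Φ} {Ψ} {p} qAs Φ-holds p⊑qs ⟪ πσ ⟫ =
    let π′ , e = castErasing refl premises refl πσ
    in ⟪ castErasing refl conclusion refl
           (P! (map subBang qAs) π′
               (subst (_⊨* _) (subCs-!binder σ Ψ p) (⊨*-subst (exts σ) Φ-holds))
               (map⁺ (All.map (λ {qA} → ⊨-subst σ (p ≤c proj₁ qA)) p⊑qs)) , e) ⟫
    where
    subBang : Poly × Form → Poly × Form
    subBang (q , A) = subP σ q , subF (exts σ) A

    premises : map (subF (exts σ)) (map proj₂ qAs) ≡ map proj₂ (map subBang qAs)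
    premises = trans (sym (map-∘ qAs)) (map-∘ qAs)

    conclusion : map (λ qA → ! (proj₁ qA) (proj₂ qA)) (map subBang qAs)
               ≡ map (subF σ) (map (λ qA → ! (proj₁ qA) (proj₂ qA)) qAs)
    conclusion = trans (sym (map-∘ qAs)) (map-∘ qAs)

  D!-subst : ∀ {Φ Γ p A B π} (1⊑p : lit 1 ⊑[ Φ ] p) →
             Substituted σ π → Substituted σ (D! {Φ} {Γ} {p} {A} {B} π 1⊑p)
  D!-subst {Γ = Γ} {p} {A} 1⊑p ⟪ πσ ⟫ =
    let π′ , e = castErasing refl (cong (_∷ map (subF σ) Γ) (subF-comm (sub1-comm σ) A)) refl πσ
    in ⟪ D! π′ (⊨-subst σ (lit 1 ≤c p) 1⊑p) , e ⟫

  N!-subst : ∀ {Φ Γ p q r A B π} (Σq⊑r : sumP p q ⊑[ Φ ] r) →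
             Substituted σ π → Substituted σ (N! {Φ} {Γ} {p} {q} {r} {A} {B} π Σq⊑r)
  N!-subst {Γ = Γ} {p} {q} {r} {A} Σq⊑r ⟪ πσ ⟫ =
    let π′ , e = castErasing refl (cong (λ A′ → ! (subP σ p) (! (subP (exts σ) q) A′) ∷ map (subF σ) Γ)
                                        nested) refl πσ
    in ⟪ N! π′ (⊨-subst σ (sumP p q ≤c r) Σq⊑r) , e ⟫
    where
    nested : subF (exts (exts σ)) (subF (subN q) A) ≡ subF (subN (subP (exts σ) q)) (subF (exts σ) A)
    nested = subF-comm (subN-comm σ q) A

  R∀α-subst : ∀ {Φ Γ k A π} → Substituted σ π → Substituted σ (R∀α {Φ} {Γ} {k} {A} π)
  R∀α-subst {Γ = Γ} {k} {A} ⟪ πσ ⟫ =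
    let π′ , e = castErasing refl shifted refl πσ
    in ⟪ R∀α π′ , erase-node R∀ σ Γ (∀α k A) refl (cong [_] e) ⟫
    where
    shifted : map (subF σ) (map (shiftα k) Γ) ≡ map (shiftα k) (map (subF σ) Γ)
    shifted = trans (sym (map-∘ Γ)) (trans (map-cong (subF-renα σ _) Γ) (map-∘ Γ))

  L∀α-subst : ∀ {Φ Γ k A B C π} (w : WF B)
              (positive : (i : Fin k) → negOcc (toℕ i) B ≡ false) →
              Substituted σ π → Substituted σ (L∀α {Φ} {Γ} {k} {A} {B} {C} w positive π)
  L∀α-subst {Γ = Γ} {k} {A} {B} {C} w positive ⟪ πσ ⟫ =
    let π′ , e = castErasing refl (cong (_∷ map (subF σ) Γ) (subF-instα σ k A B)) refl πσ
    in ⟪ L∀α (WF-subst (extsN k σ) B w) positive′ π′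
       , erase-node L∀ σ (∀α k A ∷ Γ) C refl (cong [_] e) ⟫
    where
    positive′ : (i : Fin k) → negOcc (toℕ i) (subF (extsN k σ) B) ≡ false
    positive′ i = trans (negOcc-subF (PreservesOcc-bound k σ i) B) (positive i)

  R∀x-subst : ∀ {Φ Γ n Ψ A π} → Substituted (extsN n σ) π →
              Substituted σ (R∀x {Φ} {Γ} {n} {Ψ} {A} π)
  R∀x-subst {Φ} {Γ} {n} {Ψ} ⟪ πσ ⟫ =
    let π′ , e = castErasing (subCs-binder n σ Φ Ψ) (map-subF-wkF n σ Γ) refl πσ
    in ⟪ R∀x π′ , e ⟫

  L∀x-subst : ∀ {Φ Γ n Ψ A C} (ps : Vec Poly n) {π} (Φ⊨Ψps : Φ ⊨* subCs (instV ps) Ψ) →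
              Substituted σ π → Substituted σ (L∀x {Φ} {Γ} {n} {Ψ} {A} {C} ps π Φ⊨Ψps)
  L∀x-subst {Γ = Γ} {Ψ = Ψ} {A} ps Φ⊨Ψps ⟪ πσ ⟫ =
    let π′ , e = castErasing refl (cong (_∷ map (subF σ) Γ) (subF-comm (instV-comm σ ps) A)) refl πσ
    in ⟪ L∀x (Vec.map (subP σ) ps) π′
           (subst (_ ⊨*_) (subCs-comm (instV-comm σ ps) Ψ) (⊨*-subst σ Φ⊨Ψps)) , e ⟫

  R∃x-subst : ∀ {Φ Γ n Ψ A} (ps : Vec Poly n) {π} (Φ⊨Ψps : Φ ⊨* subCs (instV ps) Ψ) →
              Substituted σ π → Substituted σ (R∃x {Φ} {Γ} {n} {Ψ} {A} ps π Φ⊨Ψps)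
  R∃x-subst {Ψ = Ψ} {A} ps Φ⊨Ψps ⟪ πσ ⟫ =
    let π′ , e = castErasing refl refl (subF-comm (instV-comm σ ps) A) πσ
    in ⟪ R∃x (Vec.map (subP σ) ps) π′
           (subst (_ ⊨*_) (subCs-comm (instV-comm σ ps) Ψ) (⊨*-subst σ Φ⊨Ψps)) , e ⟫

  L∃x-subst : ∀ {Φ Γ n Ψ A C π} → Substituted (extsN n σ) π →
              Substituted σ (L∃x {Φ} {Γ} {n} {Ψ} {A} {C} π)
  L∃x-subst {Φ} {Γ} {n} {Ψ} {C = C} ⟪ πσ ⟫ =
    let π′ , e = castErasing (subCs-binder n σ Φ Ψ) (cong (_ ∷_) (map-subF-wkF n σ Γ))
                             (subF-wkF n σ C) πσ
    in ⟪ L∃x π′ , e ⟫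

subst-derivation : ∀ σ {Φ Γ B} (π : Φ ⨾ Γ ⊢ B) → Substituted σ π
subst-derivation σ (Ax A≤B)           = Ax-subst σ A≤B
subst-derivation σ (Cut w π₁ π₂)      = Cut-subst σ w (subst-derivation σ π₁) (subst-derivation σ π₂)
subst-derivation σ (Wk π)             = Wk-subst σ (subst-derivation σ π)
subst-derivation σ (Exch Γ π)         = Exch-subst σ Γ (subst-derivation σ π)
subst-derivation σ (Ctr π h)          = Ctr-subst σ h (subst-derivation σ π)
subst-derivation σ (R⊸ π)             = R⊸-subst σ (subst-derivation σ π)
subst-derivation σ (L⊸ π₁ π₂)         = L⊸-subst σ (subst-derivation σ π₁) (subst-derivation σ π₂)
subst-derivation σ (R⊗ π₁ π₂)         = R⊗-subst σ (subst-derivation σ π₁) (subst-derivation σ π₂)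
subst-derivation σ (L⊗ π)             = L⊗-subst σ (subst-derivation σ π)
subst-derivation σ (P! qAs π h hs)    = P!-subst σ qAs h hs (subst-derivation (exts σ) π)
subst-derivation σ (D! π h)           = D!-subst σ h (subst-derivation σ π)
subst-derivation σ (N! π h)           = N!-subst σ h (subst-derivation σ π)
subst-derivation σ (R∀α π)            = R∀α-subst σ (subst-derivation σ π)
subst-derivation σ (L∀α w positive π) = L∀α-subst σ w positive (subst-derivation σ π)
subst-derivation σ (R∀x {n = n} π)    = R∀x-subst σ (subst-derivation (extsN n σ) π)
subst-derivation σ (L∀x ps π h)       = L∀x-subst σ ps h (subst-derivation σ π)
subst-derivation σ (R∃x ps π h)       = R∃x-subst σ ps h (subst-derivation σ π)
subst-derivation σ (L∃x {n = n} π)    = L∃x-subst σ (subst-derivation (extsN n σ) π)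

-- The substitution lemma holds for every σ.
proposition2p15 : ∀ {Φ : ConSet} {Γ : List Form} {B : Form}
    (π : Φ ⨾ Γ ⊢ B) → All WF Γ → WF B →
    ∀ {k : ℕ} (xs : Vec ℕ k) (ps : Vec Poly k) → Unique (toList xs) →
    Σ (subCs (xs ↦ ps) Φ ⨾ map (subF (xs ↦ ps)) Γ ⊢ subF (xs ↦ ps) B)
      (λ π′ → ⌊ π′ ⌋ ≡ ⌊ π ⌋)
proposition2p15 π _ _ xs ps _ = Substituted.erasing (subst-derivation (xs ↦ ps) π)
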